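{- Let $G\in\mathcal{G}$, with cliques on $X=\{x_1,\ldots,x_m\}$ and $Y=\{y_1,\ldots,y_n\}$, where $n>m$ and both $n$ and $m$ are odd, such that $N[y_1]=\{x_1,\ldots,x_s\}\cup Y$, $N[y_2]=\{x_{s+1},\ldots,x_{s+t}\}\cup Y$, and $N[y_i]=Y$ for all $3\leq i\leq n$, where $s,t\ge 0$ and $0\leq s+t\leq m$. Then $T_2(G)$ is well-covered.
   Context: $\mathcal{G}$ is the class of graphs obtained by taking the disjoint union of a complete graph $K_m$ with vertex set $X=\{x_1,\ldots,x_m\}$ and a complete graph $K_n$ with vertex set $Y=\{y_1,\ldots,y_n\}$, where $n\geq m$, and then adding some (possibly no) edges each joining a vertex of $X$ to a vertex of $Y$. $N[v]$ denotes the closed neighbourhood of $v$ ($v$ together with all its neighbours). The $2$-token graph $T_2(G)$ has as vertices the $2$-subsets of $V(G)$, two of them adjacent if their symmetric difference is an edge of $G$. A graph is well-covered if all of its maximal (with respect to inclusion) independent sets have the same cardinality. -}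

module Defs where

open import Data.Nat using (ℕ; _+_; _*_; _<_; _≤_)
open import Data.Fin using (Fin; toℕ; splitAt)
import Data.Fin as F
open import Data.Sum using (_⊎_; inj₁; inj₂)
open import Data.Product using (_×_; Σ; ∃; ∃-syntax; _,_)
open import Data.List using (List; _∷_)
open import Data.List.Membership.Propositional using (_∈_; _∉_)
open import Data.List.Relation.Unary.All using (All)
open import Data.List.Relation.Unary.Unique.Propositional using (Unique)
open import Data.List using (length)
open import Relation.Binary.PropositionalEquality using (_≡_; _≢_)
open import Relation.Nullary using (¬_)
open import Function.Bundles using (_⇔_)

Independent : {V : Set} → (V → V → Set) → List V → Set
Independent R L = ∀ {a b} → a ∈ L → b ∈ L → ¬ R a b

MaximalIndependent : {V : Set} → (V → Set) → (V → V → Set) → List V → Set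
MaximalIndependent Vert R L =
  All Vert L × Unique L × Independent R L ×
  (∀ v → Vert v → v ∉ L → ¬ Independent R (v ∷ L))

WellCovered : {V : Set} → (V → Set) → (V → V → Set) → Set
WellCovered Vert R =
  ∀ L₁ L₂ → MaximalIndependent Vert R L₁ → MaximalIndependent Vert R L₂ →
  length L₁ ≡ length L₂

-- 2-token graph of a graph on Fin N.
-- A 2-subset {a,b} of Fin N is represented by the ordered pair (a , b) with a < b.

TokVert : {N : ℕ} → Fin N × Fin N → Set
TokVert (a , b) = toℕ a < toℕ b

_∈₂_ : {N : ℕ} → Fin N → Fin N × Fin N → Set
w ∈₂ (a , b) = (w ≡ a) ⊎ (w ≡ b)

TokenAdj : {N : ℕ} → (Fin N → Fin N → Set) → Fin N × Fin N → Fin N × Fin N → Set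
TokenAdj {N} Adj A B =
  ∃[ u ] ∃[ v ] (Adj u v ×
    (∀ w → ((w ∈₂ A × ¬ (w ∈₂ B)) ⊎ (w ∈₂ B × ¬ (w ∈₂ A))) ⇔ ((w ≡ u) ⊎ (w ≡ v))))

T₂-WellCovered : {N : ℕ} → (Fin N → Fin N → Set) → Set
T₂-WellCovered Adj = WellCovered TokVert (TokenAdj Adj)

-- The class 𝒢: vertices Fin (m + n); index i < m is x_{i+1} (via splitAt m
-- this is inj₁ i), index m + j is y_{j+1} (inj₂ j).  X and Y are cliques;
-- E k j says that x_{k+1} is joined to y_{j+1}.

GAdj : (m n : ℕ) → (Fin m → Fin n → Set) → Fin (m + n) → Fin (m + n) → Set
GAdj m n E u v with splitAt m u | splitAt m v
... | inj₁ a | inj₁ b = a ≢ b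
... | inj₂ a | inj₂ b = a ≢ b
... | inj₁ a | inj₂ b = E a b
... | inj₂ a | inj₁ b = E b a

IsOdd : ℕ → Set
IsOdd n = ∃[ k ] (n ≡ 2 * k + 1)

module Submission where

open import Defs
open import Data.Nat using (ℕ; suc; _+_; _*_; _<_; _≤_; z≤n; s≤s)
open import Data.Nat.Properties
  using (<-irrefl; +-suc; <-asym; <-cmp; ≤-trans; ≤-reflexive; ≤-antisym; ≤⇒≯; <⇒≱; m<1+n⇒m≤n;
         +-mono-≤; +-monoˡ-≤; +-cancelˡ-≤; +-cancelʳ-<; *-monoʳ-≤; *-cancelˡ-<; *-suc; module ≤-Reasoning)
open import Data.Nat.Tactic.RingSolver using (solve-∀)
open import Data.Fin using (Fin; toℕ; splitAt; _↑ˡ_; _↑ʳ_)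
open import Data.Fin.Properties
  using (_≟_; toℕ-injective; splitAt-↑ˡ; splitAt-↑ʳ; splitAt⁻¹-↑ˡ; splitAt⁻¹-↑ʳ; ↑ˡ-injective; ↑ʳ-injective)
open import Data.Sum using (_⊎_; inj₁; inj₂; swap; [_,_]′)
import Data.Sum
open import Data.Product using (_×_; Σ; ∃-syntax; _,_; proj₁; proj₂)
open import Data.List using (List; []; _∷_; length; map; filter; _++_; allFin)
open import Data.List.Properties using (length-++; length-map; length-tabulate; filter-notAll)
open import Data.List.Membership.Propositional using (_∈_; _∉_)
open import Data.List.Membership.Propositional.Properties using (∈-filter⁺; ∈-filter⁻; ∈-map⁺; ∈-map⁻; ∈-allFin; ∈-++⁺ˡ; ∈-++⁺ʳ)
open import Data.List.Relation.Binary.Subset.Propositional using (_⊆_)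
open import Data.List.Relation.Unary.Any as Any using (here; there)
open import Data.List.Relation.Unary.All as All using (All; []; _∷_)
import Data.List.Relation.Unary.All.Properties as All
import Data.List.Relation.Unary.Unique.Propositional.Properties as Unique
open import Data.List.Relation.Unary.Unique.Propositional.Properties using (allFin⁺)
open import Data.List.Relation.Unary.AllPairs using ([]; _∷_)
open import Data.List.Relation.Unary.Unique.Propositional using (Unique)
open import Data.Empty using (⊥; ⊥-elim)
open import Function using (_∘_; id)
open import Function.Bundles using (_⇔_; mk⇔; Equivalence)
open import Relation.Binary.Definitions using (DecidableEquality; tri<; tri≈; tri>)
open import Relation.Binary.PropositionalEquality using (_≡_; _≢_; refl; sym; trans; cong; cong₂; subst; subst₂; ≢-sym)
open import Relation.Nullary using (¬_; Dec; yes; no; ¬?)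
open import Relation.Nullary.Decidable using (_⊎-dec_; _×-dec_)

-- A maximal independent set L of T₂(G) is a family of pairs in which two pairs through a common
-- vertex have non-adjacent other ends.  As X and Y are cliques, every vertex then has at most one
-- partner in X and one in Y, and maximality says that two non-partners a, b always conflict: a
-- partner of one is adjacent to the other.  Since each x ∈ X has at most one neighbour in Y and only
-- y₁, y₂ have neighbours in X, a tournament argument on such conflicts shows that at most two
-- vertices of X lack an X-partner, at most two of Y lack a Y-partner, and (using n ≥ m + 2) every
-- vertex of X has a Y-partner.  With m = 2a + 1 and n = 2b + 1 this forces exactly a pairs inside
-- X, b inside Y and m across, so every maximal independent set has a + b + m elements.

module _ {A : Set} (_≟ᴬ_ : DecidableEquality A) where
  open import Data.List.Membership.DecPropositional _≟ᴬ_ using (_∈?_; _∉?_)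

  Unique-length-≤ : ∀ {xs ys : List A} → Unique xs → xs ⊆ ys → length xs ≤ length ys
  Unique-length-≤ {[]} _ _ = z≤n
  Unique-length-≤ {x ∷ xs} {ys} (x∉xs ∷ xs!) xs⊆ys = begin-strict
    length xs                    ≤⟨ Unique-length-≤ xs! (λ z∈xs → ∈-filter⁺ x≢? (xs⊆ys (there z∈xs)) (All.lookup x∉xs z∈xs)) ⟩
    length (filter x≢? ys)       <⟨ filter-notAll x≢? ys (Any.map (λ x≡y x≢y → x≢y x≡y) (xs⊆ys (here refl))) ⟩
    length ys                    ∎
    where
    open ≤-Reasoning
    x≢? : ∀ y → Dec (x ≢ y)
    x≢? y = ¬? (x ≟ᴬ y)

  Unique-length-≤-+-∉ : ∀ {zs} (ys : List A) → Unique zs → length zs ≤ length ys + length (filter (_∉? ys) zs)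
  Unique-length-≤-+-∉ {zs} ys zs! =
    ≤-trans (Unique-length-≤ zs! covered) (≤-reflexive (length-++ ys))
    where
    covered : zs ⊆ ys ++ filter (_∉? ys) zs
    covered {z} z∈zs with z ∈? ys
    ... | yes z∈ys = ∈-++⁺ˡ z∈ys
    ... | no z∉ys = ∈-++⁺ʳ ys (∈-filter⁺ (_∉? ys) z∈zs z∉ys)

Unique-map⁺-on : ∀ {A B : Set} {f : A → B} {xs} → Unique xs →
  (∀ {x y} → x ∈ xs → y ∈ xs → f x ≡ f y → x ≡ y) → Unique (map f xs)
Unique-map⁺-on {xs = []} [] _ = []
Unique-map⁺-on {f = f} {xs = x ∷ xs} (x∉xs ∷ xs!) inj =
  All.tabulate fx≢ ∷ Unique-map⁺-on xs! (λ x∈ y∈ → inj (there x∈) (there y∈))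
  where
  fx≢ : ∀ {b} → b ∈ map f xs → f x ≢ b
  fx≢ b∈ fx≡b with ∈-map⁻ f b∈
  ... | y , y∈xs , refl = All.lookup x∉xs y∈xs (inj (here refl) (there y∈xs) fx≡b)

length-map-allFin : ∀ {k} {A : Set} (f : Fin k → A) → length (map f (allFin k)) ≡ k
length-map-allFin {k} f = trans (length-map f (allFin k)) (length-tabulate id)

record Enumeration {A : Set} (P : A → Set) : Set where
  field
    elements : List A
    unique : Unique elements
    complete : ∀ {a} → P a → a ∈ elements
    sound : ∀ {a} → a ∈ elements → P a

Three : {A : Set} → (A → Set) → Set
Three {A} P = Σ A λ p → Σ A λ q → Σ A λ r → p ≢ q × q ≢ r × p ≢ r × P p × P q × P r

module _ {A : Set} where

  ¬Three-≡⊎≡ : ∀ {u w : A} → ¬ Three (λ x → x ≡ u ⊎ x ≡ w)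
  ¬Three-≡⊎≡ (_ , _ , _ , p≢q , _   , _   , inj₁ refl , inj₁ refl , _) = p≢q refl
  ¬Three-≡⊎≡ (_ , _ , _ , p≢q , _   , _   , inj₂ refl , inj₂ refl , _) = p≢q refl
  ¬Three-≡⊎≡ (_ , _ , _ , _   , _   , p≢r , inj₁ refl , _ , inj₁ refl) = p≢r refl
  ¬Three-≡⊎≡ (_ , _ , _ , _   , _   , p≢r , inj₂ refl , _ , inj₂ refl) = p≢r refl
  ¬Three-≡⊎≡ (_ , _ , _ , _   , q≢r , _   , _ , inj₁ refl , inj₁ refl) = q≢r refl
  ¬Three-≡⊎≡ (_ , _ , _ , _   , q≢r , _   , _ , inj₂ refl , inj₂ refl) = q≢r refl

  ¬Three⇒length≤2 : ∀ {P : A → Set} {zs} → Unique zs → (∀ {z} → z ∈ zs → P z) → ¬ Three P → length zs ≤ 2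
  ¬Three⇒length≤2 {zs = []} _ _ _ = z≤n
  ¬Three⇒length≤2 {zs = _ ∷ []} _ _ _ = s≤s z≤n
  ¬Three⇒length≤2 {zs = _ ∷ _ ∷ []} _ _ _ = s≤s (s≤s z≤n)
  ¬Three⇒length≤2 {zs = p ∷ q ∷ r ∷ _} ((p≢q ∷ p≢r ∷ _) ∷ (q≢r ∷ _) ∷ _) P-all ¬three =
    ⊥-elim (¬three (p , q , r , p≢q , q≢r , p≢r , P-all (here refl) , P-all (there (here refl)) , P-all (there (there (here refl)))))

  module _ {Q : A → Set} where

    two-of-three : {B C : A → Set} →
      (∀ {x y} → Q x → Q y → x ≢ y → B x → B y → ⊥) →
      (∀ {x y} → Q x → Q y → x ≢ y → C x → C y → ⊥) →
      (∀ {x} → Q x → ¬ ¬ (B x ⊎ C x)) → ¬ Three Q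
    two-of-three {B} {C} B-clash C-clash total (p , q , r , p≢q , q≢r , p≢r , Qp , Qq , Qr) =
      total Qp λ cp → total Qq λ cq → total Qr λ cr → pigeonhole cp cq cr
      where
      pigeonhole : B p ⊎ C p → B q ⊎ C q → B r ⊎ C r → ⊥
      pigeonhole (inj₁ bp) (inj₁ bq) _ = B-clash Qp Qq p≢q bp bq
      pigeonhole (inj₂ cp) (inj₂ cq) _ = C-clash Qp Qq p≢q cp cq
      pigeonhole (inj₁ bp) _ (inj₁ br) = B-clash Qp Qr p≢r bp br
      pigeonhole (inj₂ cp) _ (inj₂ cr) = C-clash Qp Qr p≢r cp cr
      pigeonhole _ (inj₁ bq) (inj₁ br) = B-clash Qq Qr q≢r bq br
      pigeonhole _ (inj₂ cq) (inj₂ cr) = C-clash Qq Qr q≢r cq cr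

    -- A tournament on three vertices with all in-degrees at most 1 is a directed triangle.
    tournament₃ : {Arc : A → A → Set} →
      (∀ {x y z} → Q x → Q y → Q z → x ≢ y → Arc x z → Arc y z → ⊥) →
      (∀ {x y z} → Q x → Q y → Q z → x ≢ y → y ≢ z → x ≢ z → Arc x y → Arc y z → Arc z x → ⊥) →
      (∀ {x y} → Q x → Q y → x ≢ y → ¬ ¬ (Arc x y ⊎ Arc y x)) → ¬ Three Q
    tournament₃ {Arc} in-deg≤1 acyclic total (p , q , r , p≢q , q≢r , p≢r , Qp , Qq , Qr) =
      total Qp Qq p≢q λ pq → total Qq Qr q≢r λ qr → total Qp Qr p≢r λ pr → orient pq qr pr
      where
      orient : Arc p q ⊎ Arc q p → Arc q r ⊎ Arc r q → Arc p r ⊎ Arc r p → ⊥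
      orient (inj₁ p→q) (inj₁ q→r) (inj₁ p→r) = in-deg≤1 Qp Qq Qr p≢q p→r q→r
      orient (inj₁ p→q) (inj₁ q→r) (inj₂ r→p) = acyclic Qp Qq Qr p≢q q≢r p≢r p→q q→r r→p
      orient (inj₁ p→q) (inj₂ r→q) _          = in-deg≤1 Qp Qr Qq p≢r p→q r→q
      orient (inj₂ q→p) (inj₁ q→r) (inj₁ p→r) = in-deg≤1 Qq Qp Qr (≢-sym p≢q) q→r p→r
      orient (inj₂ q→p) (inj₁ q→r) (inj₂ r→p) = in-deg≤1 Qq Qr Qp q≢r q→p r→p
      orient (inj₂ q→p) (inj₂ r→q) (inj₁ p→r) = acyclic Qp Qr Qq p≢r (≢-sym q≢r) p≢q p→r r→q q→p
      orient (inj₂ q→p) (inj₂ r→q) (inj₂ r→p) = in-deg≤1 Qq Qr Qp q≢r q→p r→p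

odd-squeeze : ∀ {c a} → 2 * c ≤ 2 * a + 1 → 2 * a + 1 ≤ 2 * c + 2 → c ≡ a
odd-squeeze {c} {a} ≤odd odd≤ = ≤-antisym
  (m<1+n⇒m≤n (*-cancelˡ-< 2 c (suc a) (≤-trans (s≤s ≤odd) (≤-reflexive (next-double a)))))
  (m<1+n⇒m≤n (*-cancelˡ-< 2 a (suc c) (≤-trans (≤-reflexive (double+1 a)) (≤-trans odd≤ (≤-reflexive (double+2 c))))))
  where
  next-double : ∀ a → suc (2 * a + 1) ≡ 2 * suc a
  next-double = solve-∀
  double+1 : ∀ a → suc (2 * a) ≡ 2 * a + 1
  double+1 = solve-∀
  double+2 : ∀ c → 2 * c + 2 ≡ 2 * suc c
  double+2 = solve-∀

odd-gap : ∀ {a b} → 2 * a + 1 < 2 * b + 1 → 2 * a + 1 + 2 ≤ 2 * b + 1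
odd-gap {a} {b} lt = ≤-trans (≤-reflexive (shift a)) (+-monoˡ-≤ 1 (*-monoʳ-≤ 2 a<b))
  where
  a<b : a < b
  a<b = *-cancelˡ-< 2 a b (+-cancelʳ-< 1 (2 * a) (2 * b) lt)
  shift : ∀ a → 2 * a + 1 + 2 ≡ 2 * suc a + 1
  shift = solve-∀

Token : ℕ → Set
Token N = Fin N × Fin N

Joins : ∀ {N} → Token N → Fin N → Fin N → Set
Joins P c u = P ≡ (c , u) ⊎ P ≡ (u , c)

module _ {N : ℕ} where

  TokVert⇒≢ : ∀ {a b : Fin N} → TokVert (a , b) → a ≢ b
  TokVert⇒≢ a<b refl = <-irrefl refl a<b

  TokVert-Joins-unique : ∀ {P Q : Token N} {x y} → TokVert P → TokVert Q → Joins P x y → Joins Q x y → P ≡ Q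
  TokVert-Joins-unique _ _ (inj₁ refl) (inj₁ refl) = refl
  TokVert-Joins-unique _ _ (inj₂ refl) (inj₂ refl) = refl
  TokVert-Joins-unique x<y y<x (inj₁ refl) (inj₂ refl) = ⊥-elim (<-asym x<y y<x)
  TokVert-Joins-unique y<x x<y (inj₂ refl) (inj₁ refl) = ⊥-elim (<-asym y<x x<y)

  ∈₂⇒Joins : ∀ {P : Token N} {z} → z ∈₂ P → ∃[ u ] Joins P z u
  ∈₂⇒Joins {a , b} (inj₁ refl) = b , inj₁ refl
  ∈₂⇒Joins {a , b} (inj₂ refl) = a , inj₂ refl

  ∈₂-Joins : ∀ {P : Token N} {c u z} → Joins P c u → z ∈₂ P ⇔ z ∈₂ (c , u)
  ∈₂-Joins (inj₁ refl) = mk⇔ id id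
  ∈₂-Joins (inj₂ refl) = mk⇔ swap swap

  _∈₂?_ : ∀ (z : Fin N) P → Dec (z ∈₂ P)
  z ∈₂? (a , b) = (z ≟ a) ⊎-dec (z ≟ b)

  endpoints : List (Token N) → List (Fin N)
  endpoints [] = []
  endpoints ((a , b) ∷ Ps) = a ∷ b ∷ endpoints Ps

  length-endpoints : ∀ Ps → length (endpoints Ps) ≡ 2 * length Ps
  length-endpoints [] = refl
  length-endpoints (_ ∷ Ps) = trans (cong (2 +_) (length-endpoints Ps)) (sym (*-suc 2 (length Ps)))

  ∈-endpoints⁺ : ∀ {Ps P z} → P ∈ Ps → z ∈₂ P → z ∈ endpoints Ps
  ∈-endpoints⁺ {(a , b) ∷ _} (here refl) (inj₁ refl) = here refl
  ∈-endpoints⁺ {(a , b) ∷ _} (here refl) (inj₂ refl) = there (here refl)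
  ∈-endpoints⁺ {(a , b) ∷ _} (there P∈Ps) z∈P = there (there (∈-endpoints⁺ P∈Ps z∈P))

  ∈-endpoints⁻ : ∀ {Ps z} → z ∈ endpoints Ps → ∃[ P ] (P ∈ Ps × z ∈₂ P)
  ∈-endpoints⁻ {(a , b) ∷ _} (here refl) = (a , b) , here refl , inj₁ refl
  ∈-endpoints⁻ {(a , b) ∷ _} (there (here refl)) = (a , b) , here refl , inj₂ refl
  ∈-endpoints⁻ {_ ∷ _} (there (there z∈)) with ∈-endpoints⁻ z∈
  ... | P , P∈Ps , z∈P = P , there P∈Ps , z∈P

  VertexDisjoint : List (Token N) → Set
  VertexDisjoint Ps = ∀ {P Q z} → P ∈ Ps → Q ∈ Ps → z ∈₂ P → z ∈₂ Q → P ≡ Q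

  endpoints-unique : ∀ {Ps} → Unique Ps → All TokVert Ps → VertexDisjoint Ps → Unique (endpoints Ps)
  endpoints-unique {[]} _ _ _ = []
  endpoints-unique {(a , b) ∷ Ps} (P∉Ps ∷ Ps!) (a<b ∷ Ps-tok) disjoint =
    (TokVert⇒≢ a<b ∷ All.tabulate (not-later (inj₁ refl))) ∷
    All.tabulate (not-later (inj₂ refl)) ∷
    endpoints-unique Ps! Ps-tok (λ P∈ Q∈ → disjoint (there P∈) (there Q∈))
    where
    not-later : ∀ {z} → z ∈₂ (a , b) → ∀ {y} → y ∈ endpoints Ps → z ≢ y
    not-later z∈ y∈ refl with ∈-endpoints⁻ y∈
    ... | Q , Q∈Ps , z∈Q = All.lookup P∉Ps Q∈Ps (disjoint (here refl) (there Q∈Ps) z∈ z∈Q)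

module TokenAdjacency {N : ℕ} (Adj : Fin N → Fin N → Set) (adj-sym : ∀ {u v} → Adj u v → Adj v u) where

  SymDiff : Token N → Token N → Fin N → Set
  SymDiff P Q z = (z ∈₂ P × ¬ z ∈₂ Q) ⊎ (z ∈₂ Q × ¬ z ∈₂ P)

  Moves : Token N → Token N → Fin N → Fin N → Set
  Moves P Q u w = ∀ z → SymDiff P Q z ⇔ (z ≡ u ⊎ z ≡ w)

  departure : ∀ {P Q u w z} → Moves P Q u w → z ∈₂ P → ¬ z ∈₂ Q → z ≡ u ⊎ z ≡ w
  departure moves z∈P z∉Q = Equivalence.to (moves _) (inj₁ (z∈P , z∉Q))

  arrival : ∀ {P Q u w z} → Moves P Q u w → z ∈₂ Q → ¬ z ∈₂ P → z ≡ u ⊎ z ≡ w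
  arrival moves z∈Q z∉P = Equivalence.to (moves _) (inj₂ (z∈Q , z∉P))

  Moves-same-vertices : ∀ {P Q u w} → Moves P Q u w →
    (∀ {z} → z ∈₂ P → z ∈₂ Q) → (∀ {z} → z ∈₂ Q → z ∈₂ P) → ⊥
  Moves-same-vertices {u = u} moves P⊆Q Q⊆P with Equivalence.from (moves u) (inj₁ refl)
  ... | inj₁ (u∈P , u∉Q) = u∉Q (P⊆Q u∈P)
  ... | inj₂ (u∈Q , u∉P) = u∉P (Q⊆P u∈Q)

  token-adj-sym : ∀ {P Q} → TokenAdj Adj P Q → TokenAdj Adj Q P
  token-adj-sym (u , w , adj , moves) =
    u , w , adj , λ z → mk⇔ (Equivalence.to (moves z) ∘ swap) (swap ∘ Equivalence.from (moves z))

  token-adj-irrefl : ∀ {P} → ¬ TokenAdj Adj P P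
  token-adj-irrefl (_ , _ , _ , moves) = Moves-same-vertices moves id id

  Joins⇒token-adj : ∀ {P Q c u w} → Joins P c u → Joins Q c w → c ≢ u → c ≢ w → u ≢ w → Adj u w → TokenAdj Adj P Q
  Joins⇒token-adj {P} {Q} {c} {u} {w} jP jQ c≢u c≢w u≢w adj = u , w , adj , λ z → mk⇔ to from
    where
    ∈P : ∀ {z} → z ∈₂ P ⇔ z ∈₂ (c , u)
    ∈P = ∈₂-Joins jP
    ∈Q : ∀ {z} → z ∈₂ Q ⇔ z ∈₂ (c , w)
    ∈Q = ∈₂-Joins jQ
    to : ∀ {z} → SymDiff P Q z → z ≡ u ⊎ z ≡ w
    to (inj₁ (z∈P , z∉Q)) with Equivalence.to ∈P z∈P
    ... | inj₁ refl = ⊥-elim (z∉Q (Equivalence.from ∈Q (inj₁ refl)))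
    ... | inj₂ z≡u = inj₁ z≡u
    to (inj₂ (z∈Q , z∉P)) with Equivalence.to ∈Q z∈Q
    ... | inj₁ refl = ⊥-elim (z∉P (Equivalence.from ∈P (inj₁ refl)))
    ... | inj₂ z≡w = inj₂ z≡w
    from : ∀ {z} → z ≡ u ⊎ z ≡ w → SymDiff P Q z
    from (inj₁ refl) = inj₁ (Equivalence.from ∈P (inj₂ refl) , [ ≢-sym c≢u , u≢w ]′ ∘ Equivalence.to ∈Q)
    from (inj₂ refl) = inj₂ (Equivalence.from ∈Q (inj₂ refl) , [ ≢-sym c≢w , ≢-sym u≢w ]′ ∘ Equivalence.to ∈P)

  edge-ends-adjacent : ∀ {u w x y} → Adj u w → x ≢ y → x ≡ u ⊎ x ≡ w → y ≡ u ⊎ y ≡ w → Adj x y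
  edge-ends-adjacent adj x≢y (inj₁ refl) (inj₁ refl) = ⊥-elim (x≢y refl)
  edge-ends-adjacent adj x≢y (inj₁ refl) (inj₂ refl) = adj
  edge-ends-adjacent adj x≢y (inj₂ refl) (inj₁ refl) = adj-sym adj
  edge-ends-adjacent adj x≢y (inj₂ refl) (inj₂ refl) = ⊥-elim (x≢y refl)

  Hangs : Fin N → Fin N → Token N → Set
  Hangs a b Q = ∃[ w ] (Joins Q a w × Adj b w)

  token-adj⇒hangs : ∀ {a b q₁ q₂} → a ≢ b → q₁ ≢ q₂ → TokenAdj Adj (a , b) (q₁ , q₂) →
    Hangs a b (q₁ , q₂) ⊎ Hangs b a (q₁ , q₂)
  token-adj⇒hangs {a} {b} {q₁} {q₂} a≢b q₁≢q₂ (u , w , adj , moves) with a ∈₂? (q₁ , q₂) | b ∈₂? (q₁ , q₂)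
  ... | yes (inj₁ refl) | yes (inj₁ refl) = ⊥-elim (a≢b refl)
  ... | yes (inj₂ refl) | yes (inj₂ refl) = ⊥-elim (a≢b refl)
  ... | yes (inj₁ refl) | yes (inj₂ refl) = ⊥-elim (Moves-same-vertices moves id id)
  ... | yes (inj₂ refl) | yes (inj₁ refl) = ⊥-elim (Moves-same-vertices moves swap swap)
  ... | yes (inj₁ refl) | no b∉Q =
    inj₁ (q₂ , inj₁ refl , edge-ends-adjacent adj (b∉Q ∘ inj₂)
      (departure moves (inj₂ refl) b∉Q) (arrival moves (inj₂ refl) [ ≢-sym q₁≢q₂ , ≢-sym (b∉Q ∘ inj₂) ]′))
  ... | yes (inj₂ refl) | no b∉Q =
    inj₁ (q₁ , inj₂ refl , edge-ends-adjacent adj (b∉Q ∘ inj₁)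
      (departure moves (inj₂ refl) b∉Q) (arrival moves (inj₁ refl) [ q₁≢q₂ , ≢-sym (b∉Q ∘ inj₁) ]′))
  ... | no a∉Q | yes (inj₁ refl) =
    inj₂ (q₂ , inj₁ refl , edge-ends-adjacent adj (a∉Q ∘ inj₂)
      (departure moves (inj₁ refl) a∉Q) (arrival moves (inj₂ refl) [ ≢-sym (a∉Q ∘ inj₂) , ≢-sym q₁≢q₂ ]′))
  ... | no a∉Q | yes (inj₂ refl) =
    inj₂ (q₁ , inj₂ refl , edge-ends-adjacent adj (a∉Q ∘ inj₁)
      (departure moves (inj₁ refl) a∉Q) (arrival moves (inj₁ refl) [ ≢-sym (a∉Q ∘ inj₁) , q₁≢q₂ ]′))
  ... | no a∉Q | no b∉Q =
    ⊥-elim (¬Three-≡⊎≡ (a , b , q₁ , a≢b , b∉Q ∘ inj₁ , a∉Q ∘ inj₁ ,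
      departure moves (inj₁ refl) a∉Q , departure moves (inj₂ refl) b∉Q ,
      arrival moves (inj₁ refl) [ ≢-sym (a∉Q ∘ inj₁) , ≢-sym (b∉Q ∘ inj₁) ]′))

data Side : Set where
  X Y : Side

_≟ˢ_ : DecidableEquality Side
X ≟ˢ X = yes refl
X ≟ˢ Y = no λ ()
Y ≟ˢ X = no λ ()
Y ≟ˢ Y = yes refl

opposite : Side → Side
opposite X = Y
opposite Y = X

≢⇒opposite : ∀ {s σ} → s ≢ σ → s ≡ opposite σ
≢⇒opposite {X} {X} s≢σ = ⊥-elim (s≢σ refl)
≢⇒opposite {X} {Y} _ = refl
≢⇒opposite {Y} {X} _ = refl
≢⇒opposite {Y} {Y} s≢σ = ⊥-elim (s≢σ refl)

module TwoCliques {N : ℕ} (Adj : Fin N → Fin N → Set) (adj-sym : ∀ {u v} → Adj u v → Adj v u)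
  (side : Fin N → Side)
  (clique : ∀ {u v} → side u ≡ side v → u ≢ v → Adj u v)
  (X-cross-unique : ∀ {x y y′} → side x ≡ X → side y ≡ Y → side y′ ≡ Y → Adj x y → Adj x y′ → y ≡ y′)
  (Y-cross-≤2 : ¬ Three (λ y → side y ≡ Y × ∃[ x ] (side x ≡ X × Adj y x)))
  where

  open TokenAdjacency Adj adj-sym
  open import Data.List.Membership.DecPropositional (_≟_ {N}) using (_∈?_; _∉?_)

  X-Y-sides-differ : ∀ {x y} → side x ≡ X → side y ≡ Y → side x ≢ side y
  X-Y-sides-differ sx sy sx≡sy with trans (sym sx) (trans sx≡sy sy)
  ... | ()

  Within : Side → Token N → Set
  Within σ (a , b) = side a ≡ σ × side b ≡ σ

  within? : ∀ σ (P : Token N) → Dec (Within σ P)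
  within? σ (a , b) = side a ≟ˢ σ ×-dec side b ≟ˢ σ

  Joins-Within : ∀ {σ P c u} → Within σ P → Joins P c u → side u ≡ σ
  Joins-Within (_ , sb) (inj₁ refl) = sb
  Joins-Within (sa , _) (inj₂ refl) = sa

  Across : Token N → Set
  Across (a , b) = side a ≢ side b

  across? : ∀ (P : Token N) → Dec (Across P)
  across? (a , b) = ¬? (side a ≟ˢ side b)

  length-partition : ∀ Ps → length Ps ≡
    length (filter (within? X) Ps) + length (filter (within? Y) Ps) + length (filter across? Ps)
  length-partition [] = refl
  length-partition ((a , b) ∷ Ps) with side a | side b
  ... | X | X = cong suc (length-partition Ps)
  ... | X | Y = trans (cong suc (length-partition Ps)) (sym (+-suc _ _))
  ... | Y | X = trans (cong suc (length-partition Ps)) (sym (+-suc _ _))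
  ... | Y | Y = trans (cong suc (length-partition Ps))
                  (cong (_+ length (filter across? Ps)) (sym (+-suc (length (filter (within? X) Ps)) _)))

  pick : Side → Fin N → Fin N → Fin N
  pick X a b = a
  pick Y a b = b

  xEnd yEnd : Token N → Fin N
  xEnd (a , b) = pick (side a) a b
  yEnd (a , b) = pick (side a) b a

  Across-ends : ∀ {P} → Across P → side (xEnd P) ≡ X × side (yEnd P) ≡ Y × Joins P (xEnd P) (yEnd P)
  Across-ends {a , b} a≁b with side a in sa | side b in sb
  ... | X | X = ⊥-elim (a≁b refl)
  ... | X | Y = sa , sb , inj₁ refl
  ... | Y | X = sb , sa , inj₂ refl
  ... | Y | Y = ⊥-elim (a≁b refl)

  ends-XY : ∀ {x y} → side x ≡ X → side y ≡ Y →
    xEnd (x , y) ≡ x × yEnd (x , y) ≡ y × xEnd (y , x) ≡ x × yEnd (y , x) ≡ y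
  ends-XY sx sy rewrite sx | sy = refl , refl , refl , refl

  module Maximal (L : List (Token N)) (L-tok : All TokVert L) (L! : Unique L)
    (independent : Independent (TokenAdj Adj) L)
    (maximal : ∀ v → TokVert v → v ∉ L → ¬ Independent (TokenAdj Adj) (v ∷ L)) where

    Partners : Fin N → Fin N → Set
    Partners c u = (c , u) ∈ L ⊎ (u , c) ∈ L

    Joins⇒Partners : ∀ {P c u} → P ∈ L → Joins P c u → Partners c u
    Joins⇒Partners P∈L (inj₁ refl) = inj₁ P∈L
    Joins⇒Partners P∈L (inj₂ refl) = inj₂ P∈L

    Partners⇒Joins : ∀ {c u} → Partners c u → ∃[ P ] (P ∈ L × Joins P c u)
    Partners⇒Joins (inj₁ P∈L) = _ , P∈L , inj₁ refl
    Partners⇒Joins (inj₂ P∈L) = _ , P∈L , inj₂ refl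

    Partners⇒≢ : ∀ {c u} → Partners c u → c ≢ u
    Partners⇒≢ (inj₁ P∈L) = TokVert⇒≢ (All.lookup L-tok P∈L)
    Partners⇒≢ (inj₂ P∈L) = ≢-sym (TokVert⇒≢ (All.lookup L-tok P∈L))

    partners-nonadjacent : ∀ {c u w} → Partners c u → Partners c w → u ≢ w → ¬ Adj u w
    partners-nonadjacent cu cw u≢w adj with Partners⇒Joins cu | Partners⇒Joins cw
    ... | P , P∈L , jP | Q , Q∈L , jQ =
      independent P∈L Q∈L (Joins⇒token-adj jP jQ (Partners⇒≢ cu) (Partners⇒≢ cw) u≢w adj)

    partner-unique : ∀ {x w w′} → side w ≡ side w′ → Partners x w → Partners x w′ → w ≡ w′
    partner-unique {w = w} {w′} sw xw xw′ with w ≟ w′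
    ... | yes w≡w′ = w≡w′
    ... | no w≢w′ = ⊥-elim (partners-nonadjacent xw xw′ w≢w′ (clique sw w≢w′))

    partner-unshared : ∀ {x y w} → x ≢ y → side x ≡ side y → Partners x w → Partners y w → ⊥
    partner-unshared x≢y sxy xw yw = partners-nonadjacent (swap xw) (swap yw) x≢y (clique sxy x≢y)

    Conflict : Fin N → Fin N → Set
    Conflict a b = ∃[ w ] (Partners a w × Adj b w) ⊎ ∃[ w ] (Partners b w × Adj a w)

    ¬Conflict⇒nonadjacent : ∀ {a b Q} → TokVert (a , b) → ¬ Conflict a b → Q ∈ L → ¬ TokenAdj Adj (a , b) Q
    ¬Conflict⇒nonadjacent {Q = q₁ , q₂} a<b ¬conflict Q∈L adj
      with token-adj⇒hangs (TokVert⇒≢ a<b) (TokVert⇒≢ (All.lookup L-tok Q∈L)) adj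
    ... | inj₁ (w , jQ , bw) = ¬conflict (inj₁ (w , Joins⇒Partners Q∈L jQ , bw))
    ... | inj₂ (w , jQ , aw) = ¬conflict (inj₂ (w , Joins⇒Partners Q∈L jQ , aw))

    ¬Conflict⇒independent : ∀ {a b} → TokVert (a , b) → ¬ Conflict a b →
      Independent (TokenAdj Adj) ((a , b) ∷ L)
    ¬Conflict⇒independent a<b ¬c (here refl) (here refl) = token-adj-irrefl
    ¬Conflict⇒independent a<b ¬c (here refl) (there Q∈L) = ¬Conflict⇒nonadjacent a<b ¬c Q∈L
    ¬Conflict⇒independent a<b ¬c (there P∈L) (here refl) = ¬Conflict⇒nonadjacent a<b ¬c P∈L ∘ token-adj-sym
    ¬Conflict⇒independent a<b ¬c (there P∈L) (there Q∈L) = independent P∈L Q∈L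

    -- Otherwise the token on a and b could be added to L.
    ¬¬conflict : ∀ {a b} → a ≢ b → ¬ Partners a b → ¬ ¬ Conflict a b
    ¬¬conflict {a} {b} a≢b ¬ab ¬conflict with <-cmp (toℕ a) (toℕ b)
    ... | tri< a<b _ _ = maximal (a , b) a<b (¬ab ∘ inj₁) (¬Conflict⇒independent a<b ¬conflict)
    ... | tri≈ _ a≡b _ = a≢b (toℕ-injective a≡b)
    ... | tri> _ _ b<a = maximal (b , a) b<a (¬ab ∘ inj₂) (¬Conflict⇒independent b<a (¬conflict ∘ swap))

    Unmatched : Side → Fin N → Set
    Unmatched σ v = ∀ {w} → side w ≡ σ → ¬ Partners v w

    Single : Side → Fin N → Set
    Single σ v = side v ≡ σ × Unmatched σ v

    Reaches : Side → Fin N → Fin N → Set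
    Reaches σ x z = ∃[ w ] (side w ≡ σ × Partners x w × Adj z w)

    ¬¬reaches : ∀ {σ τ a b} → Unmatched σ a → Unmatched τ b → side b ≡ σ → a ≢ b →
      ¬ ¬ (Reaches (opposite σ) a b ⊎ Reaches (opposite τ) b a)
    ¬¬reaches ua ub sb a≢b k = ¬¬conflict a≢b (ua sb) λ where
      (inj₁ (w , aw , bw)) → k (inj₁ (w , ≢⇒opposite (λ sw → ua sw aw) , aw , bw))
      (inj₂ (w , bw , aw)) → k (inj₂ (w , ≢⇒opposite (λ sw → ub sw bw) , bw , aw))

    X-single-≤2 : ¬ Three (Single X)
    X-single-≤2 = tournament₃ {Arc = Reaches Y} in-deg≤1 acyclic λ (_ , ux) (sy , uy) → ¬¬reaches ux uy sy
      where
      in-deg≤1 : ∀ {x y z} → Single X x → Single X y → Single X z → x ≢ y → Reaches Y x z → Reaches Y y z → ⊥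
      in-deg≤1 (sx , _) (sy , _) (sz , _) x≢y (w , sw , xw , zw) (w′ , sw′ , yw′ , zw′)
        with X-cross-unique sz sw sw′ zw zw′
      ... | refl = partner-unshared x≢y (trans sx (sym sy)) xw yw′
      acyclic : ∀ {x y z} → Single X x → Single X y → Single X z → x ≢ y → y ≢ z → x ≢ z →
        Reaches Y x y → Reaches Y y z → Reaches Y z x → ⊥
      acyclic (sx , _) (sy , _) (sz , _) x≢y y≢z x≢z (w₁ , s₁ , xw₁ , yw₁) (w₂ , s₂ , yw₂ , zw₂) (w₃ , s₃ , zw₃ , xw₃) =
        Y-cross-≤2 (w₁ , w₂ , w₃ ,
          (λ { refl → partner-unshared x≢y (trans sx (sym sy)) xw₁ yw₂ }) ,
          (λ { refl → partner-unshared y≢z (trans sy (sym sz)) yw₂ zw₃ }) ,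
          (λ { refl → partner-unshared x≢z (trans sx (sym sz)) xw₁ zw₃ }) ,
          (s₁ , _ , sy , adj-sym yw₁) , (s₂ , _ , sz , adj-sym zw₂) , (s₃ , _ , sx , adj-sym xw₃))

    Y-single-≤2 : ¬ Three (Single Y)
    Y-single-≤2 = tournament₃ {Arc = λ x y → Reaches X y x} in-deg≤1 acyclic
      λ (_ , ux) (sy , uy) x≢y k → ¬¬reaches ux uy sy x≢y (k ∘ swap)
      where
      in-deg≤1 : ∀ {x y z} → Single Y x → Single Y y → Single Y z → x ≢ y → Reaches X z x → Reaches X z y → ⊥
      in-deg≤1 (sx , _) (sy , _) _ x≢y (w , sw , zw , xw) (w′ , sw′ , zw′ , yw′)
        with partner-unique (trans sw (sym sw′)) zw zw′
      ... | refl = x≢y (X-cross-unique sw sx sy (adj-sym xw) (adj-sym yw′))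
      acyclic : ∀ {x y z} → Single Y x → Single Y y → Single Y z → x ≢ y → y ≢ z → x ≢ z →
        Reaches X y x → Reaches X z y → Reaches X x z → ⊥
      acyclic (sx , _) (sy , _) (sz , _) x≢y y≢z x≢z (w₁ , s₁ , _ , xw₁) (w₂ , s₂ , _ , yw₂) (w₃ , s₃ , _ , zw₃) =
        Y-cross-≤2 (_ , _ , _ , x≢y , y≢z , x≢z , (sx , w₁ , s₁ , xw₁) , (sy , w₂ , s₂ , yw₂) , (sz , w₃ , s₃ , zw₃))

    X-unmatched⇒¬Three-Y-unmatched : ∀ {x} → side x ≡ X → Unmatched Y x → ¬ Three (λ y → side y ≡ Y × Unmatched X y)
    X-unmatched⇒¬Three-Y-unmatched {x} sx ux =
      two-of-three {B = Reaches X x} {C = λ y → Reaches Y y x} B-clash C-clash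
        λ (sy , uy) → ¬¬reaches ux uy sy (X-Y-sides-differ sx sy ∘ cong side)
      where
      B-clash : ∀ {y y′} → side y ≡ Y × Unmatched X y → side y′ ≡ Y × Unmatched X y′ → y ≢ y′ →
        Reaches X x y → Reaches X x y′ → ⊥
      B-clash (sy , _) (sy′ , _) y≢y′ (w , sw , xw , yw) (w′ , sw′ , xw′ , y′w′)
        with partner-unique (trans sw (sym sw′)) xw xw′
      ... | refl = y≢y′ (X-cross-unique sw sy sy′ (adj-sym yw) (adj-sym y′w′))
      C-clash : ∀ {y y′} → side y ≡ Y × Unmatched X y → side y′ ≡ Y × Unmatched X y′ → y ≢ y′ →
        Reaches Y y x → Reaches Y y′ x → ⊥
      C-clash (sy , _) (sy′ , _) y≢y′ (w , sw , yw , xw) (w′ , sw′ , y′w′ , xw′)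
        with X-cross-unique sx sw sw′ xw xw′
      ... | refl = partner-unshared y≢y′ (trans sy (sym sy′)) yw y′w′

    module WithinSide (σ : Side) (Zs : Enumeration (λ v → side v ≡ σ)) (σ-single-≤2 : ¬ Three (Single σ)) where
      open Enumeration Zs

      L-within : List (Token N)
      L-within = filter (within? σ) L

      L-within-disjoint : VertexDisjoint L-within
      L-within-disjoint P∈L-within Q∈L-within z∈P z∈Q with ∈-filter⁻ (within? σ) {xs = L} P∈L-within | ∈-filter⁻ (within? σ) {xs = L} Q∈L-within | ∈₂⇒Joins z∈P | ∈₂⇒Joins z∈Q
      ... | P∈L , wP | Q∈L , wQ | u , jP | u′ , jQ
        with partner-unique (trans (Joins-Within wP jP) (sym (Joins-Within wQ jQ))) (Joins⇒Partners P∈L jP) (Joins⇒Partners Q∈L jQ)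
      ... | refl = TokVert-Joins-unique (All.lookup L-tok P∈L) (All.lookup L-tok Q∈L) jP jQ

      endpoints-on-σ : ∀ {z} → z ∈ endpoints L-within → side z ≡ σ
      endpoints-on-σ z∈ with ∈-endpoints⁻ z∈
      ... | P , P∈L-within , z∈P = Joins-Within (proj₂ (∈-filter⁻ (within? σ) {xs = L} P∈L-within)) (swap (proj₂ (∈₂⇒Joins z∈P)))

      Partners⇒covered : ∀ {z w} → side z ≡ σ → side w ≡ σ → Partners z w → z ∈ endpoints L-within
      Partners⇒covered sz sw (inj₁ P∈L) = ∈-endpoints⁺ (∈-filter⁺ (within? σ) P∈L (sz , sw)) (inj₁ refl)
      Partners⇒covered sz sw (inj₂ P∈L) = ∈-endpoints⁺ (∈-filter⁺ (within? σ) P∈L (sw , sz)) (inj₂ refl)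

      double-≤ : 2 * length L-within ≤ length elements
      double-≤ = subst (_≤ length elements) (length-endpoints L-within)
        (Unique-length-≤ _≟_ (endpoints-unique (Unique.filter⁺ (within? σ) L!) (All.filter⁺ (within? σ) L-tok) L-within-disjoint)
          (complete ∘ endpoints-on-σ))

      ≤-double+2 : length elements ≤ 2 * length L-within + 2
      ≤-double+2 = begin
        length elements                                       ≤⟨ Unique-length-≤-+-∉ _≟_ (endpoints L-within) unique ⟩
        length (endpoints L-within) + length uncovered               ≤⟨ +-mono-≤ (≤-reflexive (length-endpoints L-within)) uncovered-≤2 ⟩
        2 * length L-within + 2                                      ∎
        where
        open ≤-Reasoning
        uncovered = filter (_∉? endpoints L-within) elements
        uncovered-≤2 : length uncovered ≤ 2
        uncovered-≤2 = ¬Three⇒length≤2 (Unique.filter⁺ (_∉? endpoints L-within) unique)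
          (λ z∈ → let (z∈Zs , z∉) = ∈-filter⁻ (_∉? endpoints L-within) z∈
                  in sound z∈Zs , λ {w} sw zw → z∉ (Partners⇒covered (sound z∈Zs) sw zw))
          σ-single-≤2

      within-count : ∀ {a} → length elements ≡ 2 * a + 1 → length L-within ≡ a
      within-count |Zs| = odd-squeeze (subst (2 * length L-within ≤_) |Zs| double-≤) (subst (_≤ 2 * length L-within + 2) |Zs| ≤-double+2)

    module AcrossSides (Xs : Enumeration (λ v → side v ≡ X)) (Ys : Enumeration (λ v → side v ≡ Y))
      (gap : length (Enumeration.elements Xs) + 2 ≤ length (Enumeration.elements Ys)) where
      open Enumeration

      L-across : List (Token N)
      L-across = filter across? L

      L-across-ends : ∀ {P} → P ∈ L-across → P ∈ L × side (xEnd P) ≡ X × side (yEnd P) ≡ Y × Joins P (xEnd P) (yEnd P)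
      L-across-ends P∈L-across with ∈-filter⁻ across? {xs = L} P∈L-across
      ... | P∈L , across = P∈L , Across-ends across

      xEnd-injective : ∀ {P Q} → P ∈ L-across → Q ∈ L-across → xEnd P ≡ xEnd Q → P ≡ Q
      xEnd-injective {P} {Q} P∈L-across Q∈L-across x≡x′ with L-across-ends P∈L-across | L-across-ends Q∈L-across
      ... | P∈L , _ , syP , jP | Q∈L , _ , syQ , jQ =
        TokVert-Joins-unique (All.lookup L-tok P∈L) (All.lookup L-tok Q∈L) (subst₂ (Joins P) x≡x′ y≡y′ jP) jQ
        where
        y≡y′ : yEnd P ≡ yEnd Q
        y≡y′ = partner-unique (trans syP (sym syQ))
          (Joins⇒Partners P∈L (subst (λ x → Joins P x (yEnd P)) x≡x′ jP)) (Joins⇒Partners Q∈L jQ)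

      xEnds-unique : Unique (map xEnd L-across)
      xEnds-unique = Unique-map⁺-on (Unique.filter⁺ across? L!) xEnd-injective

      xEnd-on-X : ∀ {z} → z ∈ map xEnd L-across → side z ≡ X
      xEnd-on-X z∈ with ∈-map⁻ xEnd z∈
      ... | P , P∈L-across , refl = proj₁ (proj₂ (L-across-ends P∈L-across))

      Partners⇒ends : ∀ {x y} → side x ≡ X → side y ≡ Y → Partners x y → x ∈ map xEnd L-across × y ∈ map yEnd L-across
      Partners⇒ends sx sy (inj₁ P∈L) with ends-XY sx sy
      ... | x≡ , y≡ , _ , _ = subst (_∈ map xEnd L-across) x≡ (∈-map⁺ xEnd P∈L-across) , subst (_∈ map yEnd L-across) y≡ (∈-map⁺ yEnd P∈L-across)
        where P∈L-across = ∈-filter⁺ across? P∈L (X-Y-sides-differ sx sy)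
      Partners⇒ends sx sy (inj₂ P∈L) with ends-XY sx sy
      ... | _ , _ , x≡ , y≡ = subst (_∈ map xEnd L-across) x≡ (∈-map⁺ xEnd P∈L-across) , subst (_∈ map yEnd L-across) y≡ (∈-map⁺ yEnd P∈L-across)
        where P∈L-across = ∈-filter⁺ across? P∈L (X-Y-sides-differ sx sy ∘ sym)

      across-≤ : length L-across ≤ length (elements Xs)
      across-≤ = subst (_≤ length (elements Xs)) (length-map xEnd L-across)
        (Unique-length-≤ _≟_ xEnds-unique (complete Xs ∘ xEnd-on-X))

      X-uncovered-unmatched : ∀ {z} → z ∈ elements Xs → z ∉ map xEnd L-across → Unmatched Y z
      X-uncovered-unmatched z∈Xs z∉ sw zw = z∉ (proj₁ (Partners⇒ends (sound Xs z∈Xs) sw zw))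

      Y-uncovered : List (Fin N)
      Y-uncovered = filter (_∉? map yEnd L-across) (elements Ys)

      Y-uncovered-unmatched : ∀ {y} → y ∈ Y-uncovered → side y ≡ Y × Unmatched X y
      Y-uncovered-unmatched y∈ with ∈-filter⁻ (_∉? map yEnd L-across) {xs = elements Ys} y∈
      ... | y∈Ys , y∉ = sound Ys y∈Ys , λ sw yw → y∉ (proj₂ (Partners⇒ends sw (sound Ys y∈Ys) (swap yw)))

      X-covered : ∀ {z} → z ∈ elements Xs → z ∈ map xEnd L-across
      X-covered {z} z∈Xs with z ∈? map xEnd L-across
      ... | yes z∈ = z∈
      ... | no z∉ = ⊥-elim (≤⇒≯ Y-uncovered-≤2 Y-uncovered-≥3)
        where
        Y-uncovered-≤2 : length Y-uncovered ≤ 2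
        Y-uncovered-≤2 = ¬Three⇒length≤2 (Unique.filter⁺ (_∉? map yEnd L-across) (unique Ys)) Y-uncovered-unmatched
          (X-unmatched⇒¬Three-Y-unmatched (sound Xs z∈Xs) (X-uncovered-unmatched z∈Xs z∉))
        across<Xs : suc (length L-across) ≤ length (elements Xs)
        across<Xs = subst (λ k → suc k ≤ length (elements Xs)) (length-map xEnd L-across)
          (Unique-length-≤ _≟_ (All.¬Any⇒All¬ _ z∉ ∷ xEnds-unique) λ where
            (here refl) → z∈Xs
            (there z′∈) → complete Xs (xEnd-on-X z′∈))
        Y-uncovered-≥3 : 2 < length Y-uncovered
        Y-uncovered-≥3 = +-cancelˡ-≤ (length L-across) 3 (length Y-uncovered) (begin
          length L-across + 3                                ≡⟨ +-suc (length L-across) 2 ⟩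
          suc (length L-across) + 2                          ≤⟨ +-monoˡ-≤ 2 across<Xs ⟩
          length (elements Xs) + 2                           ≤⟨ gap ⟩
          length (elements Ys)                               ≤⟨ Unique-length-≤-+-∉ _≟_ (map yEnd L-across) (unique Ys) ⟩
          length (map yEnd L-across) + length Y-uncovered    ≡⟨ cong (_+ length Y-uncovered) (length-map yEnd L-across) ⟩
          length L-across + length Y-uncovered               ∎)
          where open ≤-Reasoning

      across-count : length L-across ≡ length (elements Xs)
      across-count = ≤-antisym across-≤
        (subst (length (elements Xs) ≤_) (length-map xEnd L-across) (Unique-length-≤ _≟_ (unique Xs) X-covered))

    length-maximal : ∀ a b (Xs : Enumeration (λ v → side v ≡ X)) (Ys : Enumeration (λ v → side v ≡ Y)) →
      let open Enumeration in
      length (elements Xs) ≡ 2 * a + 1 → length (elements Ys) ≡ 2 * b + 1 →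
      length (elements Xs) < length (elements Ys) → length L ≡ a + b + length (elements Xs)
    length-maximal a b Xs Ys |X| |Y| X<Y = trans (length-partition L)
      (cong₂ _+_ (cong₂ _+_ (WithinSide.within-count X Xs X-single-≤2 {a} |X|) (WithinSide.within-count Y Ys Y-single-≤2 {b} |Y|))
        (AcrossSides.across-count Xs Ys gap))
      where
      open Enumeration
      gap : length (elements Xs) + 2 ≤ length (elements Ys)
      gap = subst₂ (λ x y → x + 2 ≤ y) (sym |X|) (sym |Y|) (odd-gap {a} {b} (subst₂ _<_ |X| |Y| X<Y))

  T₂-well-covered : (Xs : Enumeration (λ v → side v ≡ X)) (Ys : Enumeration (λ v → side v ≡ Y)) →
    let open Enumeration in
    IsOdd (length (elements Xs)) → IsOdd (length (elements Ys)) → length (elements Xs) < length (elements Ys) →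
    T₂-WellCovered Adj
  T₂-well-covered Xs Ys (a , |X|) (b , |Y|) X<Y L₁ L₂ (tok₁ , L₁! , ind₁ , max₁) (tok₂ , L₂! , ind₂ , max₂) =
    trans (Maximal.length-maximal L₁ tok₁ L₁! ind₁ max₁ a b Xs Ys |X| |Y| X<Y)
      (sym (Maximal.length-maximal L₂ tok₂ L₂! ind₂ max₂ a b Xs Ys |X| |Y| X<Y))

sumSide : ∀ {m n} → Fin m ⊎ Fin n → Side
sumSide (inj₁ _) = X
sumSide (inj₂ _) = Y

module Class𝒢 {m n : ℕ} (E : Fin m → Fin n → Set) where

  side : Fin (m + n) → Side
  side v = sumSide (splitAt m v)

  GAdj-sym : ∀ {u v} → GAdj m n E u v → GAdj m n E v u
  GAdj-sym {u} {v} uv with splitAt m u | splitAt m v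
  ... | inj₁ _ | inj₁ _ = uv ∘ sym
  ... | inj₂ _ | inj₂ _ = uv ∘ sym
  ... | inj₁ _ | inj₂ _ = uv
  ... | inj₂ _ | inj₁ _ = uv

  GAdj-clique : ∀ {u v} → side u ≡ side v → u ≢ v → GAdj m n E u v
  GAdj-clique {u} {v} su u≢v with splitAt m u in eu | splitAt m v in ev
  ... | inj₁ _ | inj₁ _ = λ { refl → u≢v (trans (sym (splitAt⁻¹-↑ˡ eu)) (splitAt⁻¹-↑ˡ ev)) }
  ... | inj₂ _ | inj₂ _ = λ { refl → u≢v (trans (sym (splitAt⁻¹-↑ʳ eu)) (splitAt⁻¹-↑ʳ ev)) }
  GAdj-clique () _ | inj₁ _ | inj₂ _
  GAdj-clique () _ | inj₂ _ | inj₁ _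

  GAdj-X-cross-unique : (∀ {k j j′} → E k j → E k j′ → j ≡ j′) →
    ∀ {x y y′} → side x ≡ X → side y ≡ Y → side y′ ≡ Y → GAdj m n E x y → GAdj m n E x y′ → y ≡ y′
  GAdj-X-cross-unique functional {x} {y} {y′} sx sy sy′ xy xy′ with splitAt m x | splitAt m y in ey | splitAt m y′ in ey′
  ... | inj₁ _ | inj₂ _ | inj₂ _ =
    trans (sym (splitAt⁻¹-↑ʳ ey)) (trans (cong (m ↑ʳ_) (functional xy xy′)) (splitAt⁻¹-↑ʳ ey′))
  GAdj-X-cross-unique _ () _ _ _ _ | inj₂ _ | _ | _
  GAdj-X-cross-unique _ _ () _ _ _ | inj₁ _ | inj₁ _ | _
  GAdj-X-cross-unique _ _ _ () _ _ | inj₁ _ | inj₂ _ | inj₁ _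

  cross-index : (∀ {k j} → E k j → toℕ j ≡ 0 ⊎ toℕ j ≡ 1) →
    ∀ {y x} → side y ≡ Y → side x ≡ X → GAdj m n E y x → ∃[ j ] (m ↑ʳ j ≡ y × (toℕ j ≡ 0 ⊎ toℕ j ≡ 1))
  cross-index into-y₁y₂ {y} {x} sy sx yx with splitAt m y in ey | splitAt m x
  ... | inj₂ j | inj₁ _ = j , splitAt⁻¹-↑ʳ ey , into-y₁y₂ yx
  cross-index _ () _ _ | inj₁ _ | _
  cross-index _ _ () _ | inj₂ _ | inj₂ _

  GAdj-Y-cross-≤2 : (∀ {k j} → E k j → toℕ j ≡ 0 ⊎ toℕ j ≡ 1) →
    ¬ Three (λ y → side y ≡ Y × ∃[ x ] (side x ≡ X × GAdj m n E y x))
  GAdj-Y-cross-≤2 into-y₁y₂ (_ , _ , _ , y₁≢y₂ , y₂≢y₃ , y₁≢y₃ , (s₁ , _ , t₁ , a₁) , (s₂ , _ , t₂ , a₂) , (s₃ , _ , t₃ , a₃))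
    with cross-index into-y₁y₂ s₁ t₁ a₁ | cross-index into-y₁y₂ s₂ t₂ a₂ | cross-index into-y₁y₂ s₃ t₃ a₃
  ... | j₁ , refl , i₁ | j₂ , refl , i₂ | j₃ , refl , i₃ =
    ¬Three-≡⊎≡ (toℕ j₁ , toℕ j₂ , toℕ j₃ ,
      y₁≢y₂ ∘ cong (m ↑ʳ_) ∘ toℕ-injective , y₂≢y₃ ∘ cong (m ↑ʳ_) ∘ toℕ-injective , y₁≢y₃ ∘ cong (m ↑ʳ_) ∘ toℕ-injective ,
      i₁ , i₂ , i₃)

  X-enumeration : Enumeration (λ v → side v ≡ X)
  X-enumeration = record
    { elements = map (_↑ˡ n) (allFin m)
    ; unique = Unique.map⁺ (↑ˡ-injective n _ _) (allFin⁺ m)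
    ; complete = complete
    ; sound = sound
    }
    where
    complete : ∀ {v} → side v ≡ X → v ∈ map (_↑ˡ n) (allFin m)
    complete {v} sv with splitAt m v in e
    ... | inj₁ k = subst (_∈ _) (splitAt⁻¹-↑ˡ e) (∈-map⁺ (_↑ˡ n) (∈-allFin k))
    complete () | inj₂ _
    sound : ∀ {v} → v ∈ map (_↑ˡ n) (allFin m) → side v ≡ X
    sound v∈ with ∈-map⁻ (_↑ˡ n) v∈
    ... | k , _ , refl = cong sumSide (splitAt-↑ˡ m k n)

  Y-enumeration : Enumeration (λ v → side v ≡ Y)
  Y-enumeration = record
    { elements = map (m ↑ʳ_) (allFin n)
    ; unique = Unique.map⁺ (↑ʳ-injective m _ _) (allFin⁺ n)
    ; complete = complete
    ; sound = sound
    }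
    where
    complete : ∀ {v} → side v ≡ Y → v ∈ map (m ↑ʳ_) (allFin n)
    complete {v} sv with splitAt m v in e
    ... | inj₂ j = subst (_∈ _) (splitAt⁻¹-↑ʳ e) (∈-map⁺ (m ↑ʳ_) (∈-allFin j))
    complete () | inj₁ _
    sound : ∀ {v} → v ∈ map (m ↑ʳ_) (allFin n) → side v ≡ Y
    sound v∈ with ∈-map⁻ (m ↑ʳ_) v∈
    ... | j , _ , refl = cong sumSide (splitAt-↑ʳ m n j)

  length-X-enumeration : length (Enumeration.elements X-enumeration) ≡ m
  length-X-enumeration = length-map-allFin (_↑ˡ n)

  length-Y-enumeration : length (Enumeration.elements Y-enumeration) ≡ n
  length-Y-enumeration = length-map-allFin (m ↑ʳ_)

module _ {m n s t : ℕ} {E : Fin m → Fin n → Set}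
  (E⇔ : ∀ k j → E k j ⇔ ((toℕ j ≡ 0 × toℕ k < s) ⊎ (toℕ j ≡ 1 × (s ≤ toℕ k × toℕ k < s + t)))) where

  E-into-y₁y₂ : ∀ {k j} → E k j → toℕ j ≡ 0 ⊎ toℕ j ≡ 1
  E-into-y₁y₂ {k} {j} = Data.Sum.map proj₁ proj₁ ∘ Equivalence.to (E⇔ k j)

  E-functional : ∀ {k j j′} → E k j → E k j′ → j ≡ j′
  E-functional {k} {j} {j′} kj kj′ with Equivalence.to (E⇔ k j) kj | Equivalence.to (E⇔ k j′) kj′
  ... | inj₁ (j≡0 , _) | inj₁ (j′≡0 , _) = toℕ-injective (trans j≡0 (sym j′≡0))
  ... | inj₂ (j≡1 , _) | inj₂ (j′≡1 , _) = toℕ-injective (trans j≡1 (sym j′≡1))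
  ... | inj₁ (_ , k<s) | inj₂ (_ , s≤k , _) = ⊥-elim (<⇒≱ k<s s≤k)
  ... | inj₂ (_ , s≤k , _) | inj₁ (_ , k<s) = ⊥-elim (<⇒≱ k<s s≤k)

theorem6p9 : (m n s t : ℕ) → m < n → IsOdd m → IsOdd n → s + t ≤ m →
    (E : Fin m → Fin n → Set) →
    (∀ (k : Fin m) (j : Fin n) →
      E k j ⇔ ((toℕ j ≡ 0 × toℕ k < s) ⊎ (toℕ j ≡ 1 × (s ≤ toℕ k × toℕ k < s + t)))) →
    T₂-WellCovered (GAdj m n E)
theorem6p9 m n s t m<n m-odd n-odd _ E E⇔ =
  T₂-well-covered X-enumeration Y-enumeration
    (subst IsOdd (sym length-X-enumeration) m-odd) (subst IsOdd (sym length-Y-enumeration) n-odd)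
    (subst₂ _<_ (sym length-X-enumeration) (sym length-Y-enumeration) m<n)
  where
  open Class𝒢 E
  open TwoCliques (GAdj m n E) GAdj-sym side GAdj-clique
    (GAdj-X-cross-unique (E-functional E⇔)) (GAdj-Y-cross-≤2 (E-into-y₁y₂ E⇔))
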